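{- Let $r\ge2$ and let $Q^{(1)},\dots,Q^{(r)}$ be nonempty, pairwise disjoint finite sets. The complete hypergraph $(Q^{(1)},\dots,Q^{(r)},Q^{(1)}\times\cdots\times Q^{(r)})$ is constructible by conditioning.
   Context: An $r$-partite hypergraph $(Q^{(1)},\dots,Q^{(r)},\overline{Q})$ has finite pairwise disjoint vertex classes $Q^{(j)}$ and hyperedge set $\overline{Q}\subseteq Q^{(1)}\times\cdots\times Q^{(r)}$. A homomorphism to $(P^{(1)},\dots,P^{(r)},\overline{P})$ is $f=(f^{(j)})$, $f^{(j)}:Q^{(j)}\to P^{(j)}$, mapping hyperedges of $\overline{Q}$ to hyperedges of $\overline{P}$ coordinatewise. For $P^{(j)}\subseteq Q^{(j)}$ the section hypergraph has classes $P^{(j)}$ and the hyperedges of $\overline{Q}$ all of whose vertices lie in $\bigcup_jP^{(j)}$. Constructible by conditioning (recursively, up to renaming of vertices): (1) A single hyperedge $(\{q^{(1)}\},\dots,\{q^{(r)}\},\{(q^{(1)},\dots,q^{(r)})\})$ is constructible. (2) Doubling: if $(P^{(1)}\sqcup Q^{(1)},\dots,P^{(r)}\sqcup Q^{(r)},\overline{P})$ is constructible, let $R^{(j)}=\{q':q\in Q^{(j)}\}$ be fresh copies (vertices of $P^{(j)}$ fixed, of $Q^{(j)}$ old, of $R^{(j)}$ new). For $\overline{q}\in\overline{P}$ not all of whose vertices are fixed, $\overline{q}'$ replaces each old vertex by its copy. Then the hypergraph with classes $P^{(j)}\sqcup Q^{(j)}\sqcup R^{(j)}$ and hyperedge set $\overline{P}\cup\{\overline{q}':\overline{q}\in\overline{P}\text{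 not all of whose vertices are fixed}\}$ is constructible. (3) Collapse: if $(P^{(1)}\sqcup Q^{(1)},\dots,P^{(r)}\sqcup Q^{(r)},\overline{Q})$ is constructible, $(P^{(1)},\dots,P^{(r)},\overline{P})$ is its section hypergraph on the $P^{(j)}$, and some homomorphism from $\overline{Q}$ to $\overline{P}$ is the identity on $\bigcup_jP^{(j)}$, then $(P^{(1)},\dots,P^{(r)},\overline{P})$ is constructible. -}

module Defs where

open import Data.Nat using (ℕ)
open import Data.Fin using (Fin)
open import Data.Bool using (Bool; true; false; if_then_else_)
open import Data.Unit using (⊤)
open import Data.Sum using (_⊎_; inj₁; inj₂)
open import Data.Product using (Σ; _×_; _,_; proj₁; ∃)
open import Relation.Nullary using (¬_)
open import Relation.Binary.PropositionalEquality using (_≡_)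
open import Function.Bundles using (_↔_; _⇔_; Inverse)

-- The vertex classes are the types V j (j : Fin r);
-- pairwise disjointness is automatic since a vertex of class j is tagged by j.
record Hyp (r : ℕ) : Set₁ where
  constructor hyp
  field
    V : Fin r → Set
    E : ((j : Fin r) → V j) → Set
open Hyp public

Finite : Set → Set
Finite A = ∃ λ n → A ↔ Fin n

single : (r : ℕ) → Hyp r
single r = hyp (λ _ → ⊤) (λ _ → ⊤)

-- (2) doubling. `fixed j v ≡ true` means v ∈ P⁽ʲ⁾ (fixed), otherwise v ∈ Q⁽ʲ⁾ (old).
-- New classes: P⁽ʲ⁾ ⊔ Q⁽ʲ⁾ (inj₁) ⊔ R⁽ʲ⁾ (inj₂, fresh copies of old vertices).
module _ {r : ℕ} (H : Hyp r) (fixed : (j : Fin r) → V H j → Bool) where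

  Old : Fin r → Set
  Old j = Σ (V H j) (λ v → fixed j v ≡ false)

  DV : Fin r → Set
  DV j = V H j ⊎ Old j

  copyV : (j : Fin r) → (v : V H j) → (b : Bool) → fixed j v ≡ b → DV j
  copyV j v true  _ = inj₁ v
  copyV j v false p = inj₂ (v , p)

  copyE : ((j : Fin r) → V H j) → (j : Fin r) → DV j
  copyE y j = copyV j (y j) (fixed j (y j)) Relation.Binary.PropositionalEquality.refl

  AllFixed : ((j : Fin r) → V H j) → Set
  AllFixed y = (j : Fin r) → fixed j (y j) ≡ true

  DE : ((j : Fin r) → DV j) → Set
  DE x = (Σ ((j : Fin r) → V H j) λ y → E H y × ((j : Fin r) → x j ≡ inj₁ (y j)))
       ⊎ (Σ ((j : Fin r) → V H j) λ y → E H y × ¬ AllFixed y × ((j : Fin r) → x j ≡ copyE y j))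

  double : Hyp r
  double = hyp DV DE

module _ {r : ℕ} (H : Hyp r) (inP : (j : Fin r) → V H j → Bool) where

  SV : Fin r → Set
  SV j = Σ (V H j) (λ v → inP j v ≡ true)

  section : Hyp r
  section = hyp SV (λ x → E H (λ j → proj₁ (x j)))

  RetractingHom : Set
  RetractingHom =
    Σ ((j : Fin r) → V H j → SV j) λ f →
      ((j : Fin r) (v : SV j) → f j (proj₁ v) ≡ v)
      × ((y : (j : Fin r) → V H j) → E H y → E H (λ j → proj₁ (f j (y j))))

Iso : {r : ℕ} → Hyp r → Hyp r → Set
Iso {r} H K =
  Σ ((j : Fin r) → V H j ↔ V K j) λ b →
    (x : (j : Fin r) → V H j) → E H x ⇔ E K (λ j → Inverse.to (b j) (x j))

data Constructible {r : ℕ} : Hyp r → Set₁ where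
  c-single   : Constructible (single r)
  c-double   : (H : Hyp r) (fixed : (j : Fin r) → V H j → Bool) →
               Constructible H → Constructible (double H fixed)
  c-collapse : (H : Hyp r) (inP : (j : Fin r) → V H j → Bool) →
               Constructible H → RetractingHom H inP → Constructible (section H inP)
  c-rename   : (H K : Hyp r) → Constructible H → Iso H K → Constructible K

complete : {r : ℕ} → (Fin r → Set) → Hyp r
complete Q = hyp Q (λ _ → ⊤)

-- Start from a single hyperedge and enlarge one class at a time by one vertex.
-- Doubling the complete hypergraph with every class except the j-th fixed gives
-- the complete hypergraph whose j-th class is duplicated. Collapsing onto the
-- original vertices plus the copy of one vertex of class j gives the complete
-- hypergraph with one more vertex in class j; the required retraction exists
-- because every map into a complete hypergraph is a homomorphism.
module Submission where

open import Defs
open import Data.Nat using (ℕ; zero; suc; _<_; _≥_; _≤_)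
open import Data.Nat.Properties using (≤-refl; <⇒≤; ≤-reflexive; m≤n⇒m≤1+n; m<1+n⇒m<n∨m≡n; <-irrelevant; n≮n)
open import Data.Fin using (Fin; toℕ; fromℕ<; _≟_)
open import Data.Fin.Properties using (toℕ-fromℕ<; toℕ-injective; toℕ<n; +↔⊎; 1↔⊤)
import Data.Bool as Bool
open import Data.Bool using (Bool; true; false; not)
open import Data.Unit using (⊤; tt)
open import Data.Sum using (_⊎_; inj₁; inj₂; [_,_]′; map₂)
open import Data.Sum.Function.Propositional using (_⊎-↔_)
open import Data.Product.Function.NonDependent.Propositional using (_×-↔_)
open import Data.Product using (Σ; _×_; _,_; proj₁; proj₂)
open import Function using (_∘_)
open import Relation.Nullary using (¬_; yes; no; does; contradiction; Irrelevant)
open import Relation.Nullary.Decidable using (dec-true; dec-false)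
open import Relation.Binary.PropositionalEquality
open ≡-Reasoning
open import Function.Bundles using (_↔_; Inverse; mk↔ₛ′; mk⇔)
open import Function.Properties.Inverse using (↔-refl; ↔-sym; ↔-trans)
open import Function.Related.TypeIsomorphisms using (⊎-assoc; ×-distribʳ-⊎)
open import Axiom.UniquenessOfIdentityProofs using (module Decidable⇒UIP)

Bool-irrelevant : {a b : Bool} → Irrelevant (a ≡ b)
Bool-irrelevant = Decidable⇒UIP.≡-irrelevant Bool._≟_

Fin-irrelevant : {n : ℕ} {i j : Fin n} → Irrelevant (i ≡ j)
Fin-irrelevant = Decidable⇒UIP.≡-irrelevant _≟_

irrelevant-↔ : {A B : Set} → Irrelevant A → Irrelevant B → (A → B) → (B → A) → A ↔ B
irrelevant-↔ A-irr B-irr f g = mk↔ₛ′ f g (λ _ → B-irr _ _) (λ _ → A-irr _ _)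

⊎-absentʳ : {A B : Set} → ¬ B → A ↔ (A ⊎ B)
⊎-absentʳ ¬b = mk↔ₛ′ inj₁ [ (λ a → a) , (λ b → contradiction b ¬b) ]′
                     (λ { (inj₁ _) → refl ; (inj₂ b) → contradiction b ¬b }) (λ _ → refl)

≡×-transport : {n : ℕ} {i j : Fin n} (A : Fin n → Set) → (i ≡ j × A j) ↔ (i ≡ j × A i)
≡×-transport A = mk↔ₛ′ (λ { (refl , a) → refl , a }) (λ { (refl , a) → refl , a })
                       (λ { (refl , _) → refl }) (λ { (refl , _) → refl })

∀-from-at-and-off : {r : ℕ} {j : Fin r} (P : Fin r → Set) →
                    P j → ((i : Fin r) → i ≢ j → P i) → (i : Fin r) → P i
∀-from-at-and-off {j = j} P at off i with i ≟ j
... | yes refl = at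
... | no i≢j   = off i i≢j

module _ {r : ℕ} (H : Hyp r) (fixed : (j : Fin r) → V H j → Bool)
         (y : (j : Fin r) → V H j) (j : Fin r) where

  copyE-fixed : fixed j (y j) ≡ true → copyE H fixed y j ≡ inj₁ (y j)
  copyE-fixed = go (fixed j (y j)) refl
    where
    go : (b : Bool) (p : fixed j (y j) ≡ b) → fixed j (y j) ≡ true →
         copyV H fixed j (y j) b p ≡ inj₁ (y j)
    go true  _ _ = refl
    go false p q = contradiction (trans (sym q) p) λ ()

  copyE-old : (p : fixed j (y j) ≡ false) → copyE H fixed y j ≡ inj₂ (y j , p)
  copyE-old = go (fixed j (y j)) refl
    where
    go : (b : Bool) (p : fixed j (y j) ≡ b) (q : fixed j (y j) ≡ false) →
         copyV H fixed j (y j) b p ≡ inj₂ (y j , q)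
    go true  p q = contradiction (trans (sym p) q) λ ()
    go false p q = cong (λ p → inj₂ (y j , p)) (Bool-irrelevant p q)

complete-rename : {r : ℕ} {Q Q′ : Fin r → Set} → ((j : Fin r) → Q j ↔ Q′ j) →
                  Constructible (complete Q) → Constructible (complete Q′)
complete-rename {Q = Q} {Q′} Q↔Q′ c = c-rename (complete Q) (complete Q′) c (Q↔Q′ , λ _ → mk⇔ _ _)

module _ {r : ℕ} (Q : Fin r → Set) (keep : (j : Fin r) → Q j → Bool) where

  Kept : Fin r → Set
  Kept = SV (complete Q) keep

  complete-collapse : ((j : Fin r) → Kept j) →
                      Constructible (complete Q) → Constructible (complete Kept)
  complete-collapse point c = c-collapse (complete Q) keep c (retract , retract-id , λ _ _ → tt)
    where
    retract-by : (j : Fin r) (v : Q j) (b : Bool) → keep j v ≡ b → Kept j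
    retract-by j v true  p = v , p
    retract-by j v false _ = point j

    retract : (j : Fin r) → Q j → Kept j
    retract j v = retract-by j v (keep j v) refl

    retract-id : (j : Fin r) (w : Kept j) → retract j (proj₁ w) ≡ w
    retract-id j (v , h) = go (keep j v) refl
      where
      go : (b : Bool) (p : keep j v ≡ b) → retract-by j v b p ≡ (v , h)
      go true  p = cong (v ,_) (Bool-irrelevant p h)
      go false p = contradiction (trans (sym h) p) λ ()

module _ {r : ℕ} (Q : Fin r → Set) (j : Fin r) where

  outside : (i : Fin r) → Q i → Bool
  outside i _ = not (does (i ≟ j))

  Doubled : Fin r → Set
  Doubled = DV (complete Q) outside

  old⇒≡ : {i : Fin r} → not (does (i ≟ j)) ≡ false → i ≡ j
  old⇒≡ {i} p with i ≟ j
  ... | yes i≡j = i≡j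
  ... | no  _   = contradiction p λ ()

  ≡⇒old : {i : Fin r} → i ≡ j → not (does (i ≟ j)) ≡ false
  ≡⇒old {i} i≡j = cong not (dec-true (i ≟ j) i≡j)

  ≢⇒fixed : {i : Fin r} → i ≢ j → not (does (i ≟ j)) ≡ true
  ≢⇒fixed {i} i≢j = cong not (dec-false (i ≟ j) i≢j)

  original : (i : Fin r) → Doubled i → Q i
  original i (inj₁ v)       = v
  original i (inj₂ (v , _)) = v

  original-outside : (i : Fin r) → i ≢ j → (w : Doubled i) → w ≡ inj₁ (original i w)
  original-outside i i≢j (inj₁ v)       = refl
  original-outside i i≢j (inj₂ (_ , p)) = contradiction (old⇒≡ p) i≢j

  -- A tuple is an edge of the doubling: an original edge if its j-th vertex is
  -- original, and the copy of an edge if its j-th vertex is a copy.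
  doubled-edge : (x : (i : Fin r) → Doubled i) → DE (complete Q) outside x
  doubled-edge x = by-class-j (x j) refl
    where
    y : (i : Fin r) → Q i
    y i = original i (x i)

    by-class-j : (w : Doubled j) → x j ≡ w → DE (complete Q) outside x
    by-class-j (inj₁ v) e =
      inj₁ (y , tt , ∀-from-at-and-off (λ i → x i ≡ inj₁ (y i))
                       (trans e (cong (inj₁ ∘ original j) (sym e)))
                       (λ i i≢j → original-outside i i≢j (x i)))
    by-class-j (inj₂ (v , p)) e =
      inj₂ (y , tt , (λ all-fixed → contradiction (trans (sym (all-fixed j)) p) λ ()) ,
            ∀-from-at-and-off (λ i → x i ≡ copyE (complete Q) outside y i)
              (begin
                 x j                                  ≡⟨ e ⟩
                 inj₂ (v , p)                         ≡⟨ cong (λ w → inj₂ (original j w , p)) (sym e) ⟩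
                 inj₂ (y j , p)                       ≡⟨ copyE-old (complete Q) outside y j p ⟨
                 copyE (complete Q) outside y j       ∎)
              (λ i i≢j → trans (original-outside i i≢j (x i))
                               (sym (copyE-fixed (complete Q) outside y i (≢⇒fixed i≢j)))))

  complete-double : Constructible (complete Q) → Constructible (complete Doubled)
  complete-double c =
    c-rename (double (complete Q) outside) (complete Doubled) (c-double (complete Q) outside c)
      ((λ _ → ↔-refl) , λ x → mk⇔ _ (λ _ → doubled-edge x))

complete-add-vertex : {r : ℕ} {X : Fin r → Set} (j : Fin r) →
                      Constructible (complete (λ i → ⊤ ⊎ X i)) →
                      Constructible (complete (λ i → ⊤ ⊎ (X i ⊎ i ≡ j)))
complete-add-vertex {r} {X} j c =
  complete-rename kept↔
    (complete-collapse (Doubled Q j) copy-of-tt (λ _ → inj₁ (inj₁ tt) , refl) (complete-double Q j c))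
  where
  Q : Fin r → Set
  Q i = ⊤ ⊎ X i

  copy-of-tt : (i : Fin r) → Doubled Q j i → Bool
  copy-of-tt i (inj₁ _)            = true
  copy-of-tt i (inj₂ (inj₁ _ , _)) = true
  copy-of-tt i (inj₂ (inj₂ _ , _)) = false

  kept↔ : (i : Fin r) → Kept (Doubled Q j) copy-of-tt i ↔ (⊤ ⊎ (X i ⊎ i ≡ j))
  kept↔ i = mk↔ₛ′ to from to-from from-to
    where
    to : Kept (Doubled Q j) copy-of-tt i → ⊤ ⊎ (X i ⊎ i ≡ j)
    to (inj₁ v , _)                = map₂ inj₁ v
    to (inj₂ (inj₁ _ , p) , _)     = inj₂ (inj₂ (old⇒≡ Q j p))
    to (inj₂ (inj₂ _ , _) , ())

    from : ⊤ ⊎ (X i ⊎ i ≡ j) → Kept (Doubled Q j) copy-of-tt i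
    from (inj₁ tt)          = inj₁ (inj₁ tt) , refl
    from (inj₂ (inj₁ x))    = inj₁ (inj₂ x) , refl
    from (inj₂ (inj₂ i≡j))  = inj₂ (inj₁ tt , ≡⇒old Q j i≡j) , refl

    to-from : (w : ⊤ ⊎ (X i ⊎ i ≡ j)) → to (from w) ≡ w
    to-from (inj₁ tt)         = refl
    to-from (inj₂ (inj₁ x))   = refl
    to-from (inj₂ (inj₂ i≡j)) = cong (inj₂ ∘ inj₂) (Fin-irrelevant _ _)

    from-to : (w : Kept (Doubled Q j) copy-of-tt i) → from (to w) ≡ w
    from-to (inj₁ (inj₁ tt) , h)    = cong (_ ,_) (Bool-irrelevant refl h)
    from-to (inj₁ (inj₂ x) , h)     = cong (_ ,_) (Bool-irrelevant refl h)
    from-to (inj₂ (inj₁ tt , p) , h) =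
      cong₂ (λ p h → inj₂ (inj₁ tt , p) , h) (Bool-irrelevant _ p) (Bool-irrelevant refl h)
    from-to (inj₂ (inj₂ _ , _) , ())

complete-add-vertices : {r : ℕ} {X : Fin r → Set} (j : Fin r) (k : ℕ) →
                        Constructible (complete (λ i → ⊤ ⊎ X i)) →
                        Constructible (complete (λ i → ⊤ ⊎ (X i ⊎ (i ≡ j × Fin k))))
complete-add-vertices j zero c = complete-rename (λ _ → ↔-refl ⊎-↔ ⊎-absentʳ λ { (_ , ()) }) c
complete-add-vertices j (suc k) c =
  complete-rename (λ i → ↔-refl ⊎-↔ ↔-trans (⊎-assoc _ _ _ _) (↔-refl ⊎-↔ snoc))
                  (complete-add-vertex j (complete-add-vertices j k c))
  where
  snoc : {E : Set} → ((E × Fin k) ⊎ E) ↔ (E × Fin (suc k))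
  snoc = mk↔ₛ′ [ (λ { (e , v) → e , Fin.suc v }) , (λ e → e , Fin.zero) ]′
               (λ { (e , Fin.zero) → inj₂ e ; (e , Fin.suc v) → inj₁ (e , v) })
               (λ { (_ , Fin.zero) → refl ; (_ , Fin.suc _) → refl })
               (λ { (inj₁ _) → refl ; (inj₂ _) → refl })

module Stages {r : ℕ} (m : Fin r → ℕ) where

  Stage : ℕ → Fin r → Set
  Stage t i = ⊤ ⊎ (toℕ i < t × Fin (m i))

  below-or-at : {t : ℕ} (t<r : t < r) (i : Fin r) → (toℕ i < t ⊎ i ≡ fromℕ< t<r) ↔ toℕ i < suc t
  below-or-at {t} t<r i = irrelevant-↔ disjoint <-irrelevant
    [ m≤n⇒m≤1+n , (λ { refl → ≤-reflexive (cong suc index-j) }) ]′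
    (λ p → [ inj₁ , (λ e → inj₂ (toℕ-injective (trans e (sym index-j)))) ]′ (m<1+n⇒m<n∨m≡n p))
    where
    index-j : toℕ (fromℕ< t<r) ≡ t
    index-j = toℕ-fromℕ< t<r

    disjoint : Irrelevant (toℕ i < t ⊎ i ≡ fromℕ< t<r)
    disjoint (inj₁ p)    (inj₁ q)    = cong inj₁ (<-irrelevant p q)
    disjoint (inj₂ e)    (inj₂ e′)   = cong inj₂ (Fin-irrelevant e e′)
    disjoint (inj₁ p)    (inj₂ refl) = contradiction (subst (_< t) index-j p) (n≮n t)
    disjoint (inj₂ refl) (inj₁ p)    = contradiction (subst (_< t) index-j p) (n≮n t)

  stage-step : {t : ℕ} (t<r : t < r) →
               Constructible (complete (Stage t)) → Constructible (complete (Stage (suc t)))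
  stage-step {t} t<r c = complete-rename (λ i → ↔-refl ⊎-↔ merge i) (complete-add-vertices j (m j) c)
    where
    j : Fin r
    j = fromℕ< t<r

    merge : (i : Fin r) →
            ((toℕ i < t × Fin (m i)) ⊎ (i ≡ j × Fin (m j))) ↔ (toℕ i < suc t × Fin (m i))
    merge i = ↔-trans (↔-refl ⊎-↔ ≡×-transport (Fin ∘ m))
                      (↔-trans (↔-sym ×-distribʳ-⊎) (below-or-at t<r i ×-↔ ↔-refl))

  stage-constructible : (t : ℕ) → t ≤ r → Constructible (complete (Stage t))
  stage-constructible zero    _   = complete-rename (λ _ → ⊎-absentʳ λ { (() , _) }) c-single
  stage-constructible (suc t) t<r = stage-step t<r (stage-constructible t (<⇒≤ t<r))

  final-stage↔ : (i : Fin r) → Stage r i ↔ Fin (suc (m i))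
  final-stage↔ i = ↔-trans (↔-refl ⊎-↔ below-r) (↔-sym (↔-trans +↔⊎ (1↔⊤ ⊎-↔ ↔-refl)))
    where
    below-r : (toℕ i < r × Fin (m i)) ↔ Fin (m i)
    below-r = mk↔ₛ′ proj₂ (toℕ<n i ,_) (λ _ → refl) (λ { (p , _) → cong (_, _) (<-irrelevant _ p) })

pointed-finite : {A : Set} → Finite A → A → Σ ℕ λ m → A ↔ Fin (suc m)
pointed-finite (zero  , A↔) a with Inverse.to A↔ a
... | ()
pointed-finite (suc m , A↔) _ = m , A↔

claim6p5 : (r : ℕ) → r ≥ 2 → (Q : Fin r → Set) → ((j : Fin r) → Finite (Q j)) → ((j : Fin r) → Q j) → Constructible (complete Q)
claim6p5 r _ Q finite point =
  complete-rename (λ i → ↔-trans (final-stage↔ i) (↔-sym (proj₂ (size i)))) (stage-constructible r ≤-refl)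
  where
  size : (i : Fin r) → Σ ℕ λ m → Q i ↔ Fin (suc m)
  size i = pointed-finite (finite i) (point i)

  open Stages (proj₁ ∘ size)
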